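{- Let $p$ be an odd prime and $f$ a positive integer. Then $p^f$ is a primitive weak Carmichael number if and only if $f$ is a prime.
   Context: A composite positive integer $n$ is called a weak Carmichael number if $\sum_{1\le k\le n-1,\ \gcd(k,n)=1} k^{n-1}\equiv \varphi(n)\pmod{n}$, where $\varphi$ is Euler's totient function. A weak Carmichael number $n$ is called a primitive weak Carmichael number if $n\ne m^f$ for every weak Carmichael number $m$ and every integer $f\ge 2$. -}

module Defs where

open import Data.Nat using (ℕ; zero; suc; _+_; _*_; _∸_; _^_; _≟_; _≥_)
open import Data.Nat.GCD using (gcd)
open import Data.Nat.Primality using (Composite)
open import Data.List using (List; filter; map; length; applyUpTo)
open import Data.Nat.ListAction using (sum)
open import Data.Integer using (ℤ; +_; _-_)
open import Data.Integer.Divisibility using () renaming (_∣_ to _∣ℤ_)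
open import Data.Product using (_×_)
open import Relation.Binary.PropositionalEquality using (_≡_)
open import Data.Empty using (⊥)

oneTo<n : ℕ → List ℕ
oneTo<n n = applyUpTo suc (n ∸ 1)

units : ℕ → List ℕ
units n = filter (λ k → gcd k n ≟ 1) (oneTo<n n)

φ : ℕ → ℕ
φ n = length (filter (λ k → gcd k n ≟ 1) (applyUpTo suc n))

_≡_[mod_] : ℕ → ℕ → ℕ → Set
a ≡ b [mod n ] = (+ n) ∣ℤ ((+ a) - (+ b))

weakSum : ℕ → ℕ
weakSum n = sum (map (λ k → k ^ (n ∸ 1)) (units n))

WeakCarmichael : ℕ → Set
WeakCarmichael n = Composite n × (weakSum n ≡ φ n [mod n ])

PrimitiveWeakCarmichael : ℕ → Set
PrimitiveWeakCarmichael n =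
  WeakCarmichael n × (∀ m f → WeakCarmichael m → f ≥ 2 → n ≡ m ^ f → ⊥)

-- For n = p ^ (f + 1) with p an odd prime, both weakSum n and φ n are ≡ (p - 1) p ^ f (mod n). Group the
-- k < n prime to p by their residue s modulo p: each class is the progression s + p t with t < p ^ f, and
-- for odd p and p ∣ P one has ∑[ t < p ^ m ] (a + P t) ^ e ≡ p ^ m a ^ e (mod p ^ m P), by expanding to first
-- order in P for m = 1 and inducting on m. Since p - 1 ∣ n - 1, Fermat gives s ^ (n - 1) ≡ 1 (mod p), so every
-- class contributes p ^ f to weakSum n, as it does to φ n. Hence p ^ f is a weak Carmichael number exactly
-- when it is composite, i.e. f ≥ 2; and as p ^ f = (p ^ g) ^ h forces f = g h, it is primitive exactly when
-- f is prime.

module Submission where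

open import Defs
import Algebra.Properties.Semiring.Binomial as Binomial
import Algebra.Definitions.RawSemiring as RawSemiring
open import Data.Bool using (true; false; if_then_else_)
open import Data.Empty using (⊥; ⊥-elim)
open import Data.Fin using (toℕ)
import Data.Integer as ℤ
import Data.Integer.Properties as ℤₚ
import Data.Integer.Divisibility.Signed as ℤ∣
import Data.Integer.Tactic.RingSolver as ℤ-Ring
open import Data.List using (List; []; _∷_; filter; map; length; applyUpTo)
open import Data.Nat using (ℕ; zero; suc; _+_; _*_; _∸_; _^_; _≤_; _<_; _≥_; _≟_; z≤n; s≤s; 2+;
  +-*-rawSemiring; nonTrivial⇒n>1; n>1⇒nonTrivial)
open import Data.Nat.Properties
open import Algebra.Properties.CommutativeSemigroup +-commutativeSemigroup
  using () renaming (interchange to +-interchange)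
open import Data.Nat.Combinatorics using (_C_; nC1≡n; nCn≡1; nCk+nC[k+1]≡[n+1]C[k+1])
open import Data.Nat.Coprimality using (Coprime; coprime-divisor)
open import Data.Nat.Divisibility using (_∣_; _∤_; divides; _∣?_; _∣0; >⇒∤; ∣-refl; ∣-reflexive; ∣-trans;
  ∣1⇒≡1; m∣m*n; n∣m*n; ∣m⇒∣m*n; ∣n⇒∣m*n; ∣m+n∣m⇒∣n; *-pres-∣; *-cancelˡ-∣)
open import Data.Nat.Divisibility.Core using (hasNonTrivialDivisor)
open import Data.Nat.DivMod using (_%_; _/_; m≡m%n+[m/n]*n; m%n<n)
open import Data.Nat.GCD using (gcd; gcd[m,n]∣m; gcd[m,n]∣n; gcd-greatest)
open import Data.Nat.ListAction using (sum)
open import Data.Nat.Primality using (Prime; Composite; euclidsLemma; prime⇒nonZero; prime⇒nonTrivial;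
  prime⇒irreducible; prime⇒¬composite; ¬prime[1]; ¬composite[1]; ¬composite⇒prime)
open import Data.Nat.Tactic.RingSolver using (solve-∀)
open import Data.Product using (∃-syntax; _×_; _,_; proj₁)
open import Data.Sum using (inj₁; inj₂; [_,_]′)
open import Function using (_∘_; id)
open import Function.Bundles using (_⇔_; mk⇔; Equivalence)
open import Relation.Binary using (tri<; tri≈; tri>)
open import Relation.Binary.PropositionalEquality
import Relation.Binary.Reasoning.Base.Single as SingleReasoning
open import Relation.Nullary using (does; yes; no; ¬_)
open import Relation.Nullary.Decidable using (dec-true; dec-false)
open import Relation.Unary using (Pred; Decidable)

∑ : ℕ → (ℕ → ℕ) → ℕ
∑ zero    f = 0
∑ (suc m) f = f 0 + ∑ m (f ∘ suc)

infixl 10 ∑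
syntax ∑ m (λ k → e) = ∑[ k < m ] e

∑-cong : ∀ m {f g : ℕ → ℕ} → (∀ k → k < m → f k ≡ g k) → ∑ m f ≡ ∑ m g
∑-cong zero    eq = refl
∑-cong (suc m) eq = cong₂ _+_ (eq 0 (s≤s z≤n)) (∑-cong m (λ k k<m → eq (suc k) (s≤s k<m)))

∑-distrib-+ : ∀ m (f g : ℕ → ℕ) → ∑[ k < m ] (f k + g k) ≡ ∑ m f + ∑ m g
∑-distrib-+ zero    f g = refl
∑-distrib-+ (suc m) f g = trans (cong (f 0 + g 0 +_) (∑-distrib-+ m (f ∘ suc) (g ∘ suc)))
                                (+-interchange (f 0) (g 0) (∑ m (f ∘ suc)) (∑ m (g ∘ suc)))

*-distribˡ-∑ : ∀ m c (f : ℕ → ℕ) → ∑[ k < m ] (c * f k) ≡ c * ∑ m f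
*-distribˡ-∑ zero    c f = sym (*-zeroʳ c)
*-distribˡ-∑ (suc m) c f =
  trans (cong (c * f 0 +_) (*-distribˡ-∑ m c (f ∘ suc))) (sym (*-distribˡ-+ c (f 0) _))

∑-const : ∀ m c → ∑[ k < m ] c ≡ m * c
∑-const zero    c = refl
∑-const (suc m) c = cong (c +_) (∑-const m c)

∑-init-last : ∀ m (f : ℕ → ℕ) → ∑ (suc m) f ≡ ∑ m f + f m
∑-init-last zero    f = +-comm (f 0) 0
∑-init-last (suc m) f = trans (cong (f 0 +_) (∑-init-last m (f ∘ suc))) (sym (+-assoc (f 0) _ _))

∑-split : ∀ m n (f : ℕ → ℕ) → ∑ (m + n) f ≡ ∑ m f + ∑[ k < n ] f (m + k)
∑-split zero    n f = refl
∑-split (suc m) n f = trans (cong (f 0 +_) (∑-split m n (f ∘ suc))) (sym (+-assoc (f 0) _ _))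

∑-comm : ∀ m n (f : ℕ → ℕ → ℕ) → ∑[ i < m ] ∑[ j < n ] f i j ≡ ∑[ j < n ] ∑[ i < m ] f i j
∑-comm zero    n f = sym (trans (∑-const n 0) (*-zeroʳ n))
∑-comm (suc m) n f = trans (cong (∑ n (f 0) +_) (∑-comm m n (f ∘ suc)))
                           (sym (∑-distrib-+ n (f 0) (λ j → ∑[ i < m ] f (suc i) j)))

∑-blocks : ∀ m n (f : ℕ → ℕ) → ∑ (m * n) f ≡ ∑[ j < n ] ∑[ i < m ] f (i * n + j)
∑-blocks m n f = trans (rows m f) (∑-comm m n (λ i j → f (i * n + j)))
  where
  rows : ∀ m (f : ℕ → ℕ) → ∑ (m * n) f ≡ ∑[ i < m ] ∑[ j < n ] f (i * n + j)
  rows zero    f = refl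
  rows (suc m) f = trans (∑-split n (m * n) f) (cong (∑ n f +_)
    (trans (rows m (λ k → f (n + k)))
           (∑-cong m (λ i _ → ∑-cong n (λ j _ → cong f (sym (+-assoc n (i * n) j)))))))

∑-id-double : ∀ m → 2 * ∑[ k < m ] k + m ≡ m * m
∑-id-double zero    = refl
∑-id-double (suc m) = begin
  2 * ∑ (suc m) id + suc m      ≡⟨ cong (λ s → 2 * s + suc m) (∑-init-last m id) ⟩
  2 * (∑ m id + m) + suc m      ≡⟨ shuffle (∑ m id) m ⟩
  (2 * ∑ m id + m) + 2 * m + 1  ≡⟨ cong (λ s → s + 2 * m + 1) (∑-id-double m) ⟩
  m * m + 2 * m + 1             ≡⟨ square-suc m ⟩
  suc m * suc m                 ∎
  where
  open ≡-Reasoning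
  shuffle : ∀ s m → 2 * (s + m) + suc m ≡ (2 * s + m) + 2 * m + 1
  shuffle = solve-∀
  square-suc : ∀ m → m * m + 2 * m + 1 ≡ suc m * suc m
  square-suc = solve-∀

∑-id-odd : ∀ r → ∑[ k < suc (2 * r) ] k ≡ suc (2 * r) * r
∑-id-odd r = *-cancelˡ-≡ _ _ 2 (+-cancelʳ-≡ m _ _ (trans (∑-id-double m) (odd-square r)))
  where
  m = suc (2 * r)
  odd-square : ∀ r → suc (2 * r) * suc (2 * r) ≡ 2 * (suc (2 * r) * r) + suc (2 * r)
  odd-square = solve-∀

-- a ≡ b (mod n) with a ≥ b, witnessed in ℕ (the congruence _≡_[mod_] of Defs lives in ℤ).
infix 4 _≡⁺_[mod_]
record _≡⁺_[mod_] (a b n : ℕ) : Set where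
  constructor addMultiple
  field
    multiplier : ℕ
    equation   : a ≡ b + n * multiplier

≡⁺-refl : ∀ {n a} → a ≡⁺ a [mod n ]
≡⁺-refl {n} {a} = addMultiple 0 (sym (trans (cong (a +_) (*-zeroʳ n)) (+-identityʳ a)))

≡⇒≡⁺ : ∀ {n a b} → a ≡ b → a ≡⁺ b [mod n ]
≡⇒≡⁺ refl = ≡⁺-refl

≡⁺-trans : ∀ {n a b c} → a ≡⁺ b [mod n ] → b ≡⁺ c [mod n ] → a ≡⁺ c [mod n ]
≡⁺-trans {n} (addMultiple k refl) (addMultiple l refl) = addMultiple (l + k) (regroup _ n l k)
  where
  regroup : ∀ c n l k → c + n * l + n * k ≡ c + n * (l + k)
  regroup = solve-∀

m+n*o≡⁺m : ∀ m n o → m + n * o ≡⁺ m [mod n ]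
m+n*o≡⁺m m n o = addMultiple o refl

module ≡⁺-Reasoning (n : ℕ) = SingleReasoning (λ a b → a ≡⁺ b [mod n ]) ≡⁺-refl ≡⁺-trans

+-cong-≡⁺ : ∀ {n a b c d} → a ≡⁺ b [mod n ] → c ≡⁺ d [mod n ] → a + c ≡⁺ b + d [mod n ]
+-cong-≡⁺ {n} {b = b} {d = d} (addMultiple k refl) (addMultiple l refl) =
  addMultiple (k + l) (regroup b d n k l)
  where
  regroup : ∀ b d n k l → b + n * k + (d + n * l) ≡ b + d + n * (k + l)
  regroup = solve-∀

*-cong-≡⁺ : ∀ {n a b c d} → a ≡⁺ b [mod n ] → c ≡⁺ d [mod n ] → a * c ≡⁺ b * d [mod n ]
*-cong-≡⁺ {n} {b = b} {d = d} (addMultiple k refl) (addMultiple l refl) =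
  addMultiple (b * l + k * d + n * k * l) (expand b d n k l)
  where
  expand : ∀ b d n k l → (b + n * k) * (d + n * l) ≡ b * d + n * (b * l + k * d + n * k * l)
  expand = solve-∀

*-congˡ-≡⁺ : ∀ {n a b} c → a ≡⁺ b [mod n ] → c * a ≡⁺ c * b [mod n ]
*-congˡ-≡⁺ c = *-cong-≡⁺ (≡⁺-refl {a = c})

^-cong-≡⁺ : ∀ {n a b} e → a ≡⁺ b [mod n ] → a ^ e ≡⁺ b ^ e [mod n ]
^-cong-≡⁺ zero    a≡⁺b = ≡⁺-refl
^-cong-≡⁺ (suc e) a≡⁺b = *-cong-≡⁺ a≡⁺b (^-cong-≡⁺ e a≡⁺b)

*-scale-≡⁺ : ∀ {n a b} c → a ≡⁺ b [mod n ] → c * a ≡⁺ c * b [mod c * n ]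
*-scale-≡⁺ {n} {b = b} c (addMultiple k refl) = addMultiple k (distribute c b n k)
  where
  distribute : ∀ c b n k → c * (b + n * k) ≡ c * b + c * n * k
  distribute = solve-∀

∣-weaken-≡⁺ : ∀ {n d a b} → d ∣ n → a ≡⁺ b [mod n ] → a ≡⁺ b [mod d ]
∣-weaken-≡⁺ {d = d} {b = b} (divides q refl) (addMultiple k refl) =
  addMultiple (q * k) (cong (b +_) (reassociate q d k))
  where
  reassociate : ∀ q d k → q * d * k ≡ d * (q * k)
  reassociate = solve-∀

∣⇒≡⁺0 : ∀ {n a} → n ∣ a → a ≡⁺ 0 [mod n ]
∣⇒≡⁺0 {n} (divides k refl) = addMultiple k (*-comm k n)

≡⁺⇒∣∸ : ∀ {n a b} → a ≡⁺ b [mod n ] → n ∣ a ∸ b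
≡⁺⇒∣∸ {n} {b = b} (addMultiple k refl) = divides k (trans (m+n∸m≡n b (n * k)) (*-comm n k))

∣∸⇒≡⁺ : ∀ {n a b} → b ≤ a → n ∣ a ∸ b → a ≡⁺ b [mod n ]
∣∸⇒≡⁺ {n} {a} {b} b≤a (divides k a∸b≡kn) =
  addMultiple k (trans (sym (m+[n∸m]≡n b≤a)) (cong (b +_) (trans a∸b≡kn (*-comm k n))))

∑-cong-≡⁺ : ∀ {n} m {f g : ℕ → ℕ} → (∀ k → k < m → f k ≡⁺ g k [mod n ]) →
  ∑ m f ≡⁺ ∑ m g [mod n ]
∑-cong-≡⁺ zero    fg = ≡⁺-refl
∑-cong-≡⁺ (suc m) fg = +-cong-≡⁺ (fg 0 (s≤s z≤n)) (∑-cong-≡⁺ m (λ k k<m → fg (suc k) (s≤s k<m)))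

≡⁺-common⇒≡[mod] : ∀ {n a b c} → a ≡⁺ c [mod n ] → b ≡⁺ c [mod n ] → a ≡ b [mod n ]
≡⁺-common⇒≡[mod] {n} {c = c} (addMultiple k refl) (addMultiple l refl) =
  ℤ∣.∣⇒∣ᵤ (ℤ∣.divides (+ k -ℤ + l) (begin
    + (c + n * k) -ℤ + (c + n * l)                   ≡⟨ cong₂ _-ℤ_ (cast k) (cast l) ⟩
    (+ c +ℤ + n *ℤ + k) -ℤ (+ c +ℤ + n *ℤ + l)      ≡⟨ difference (+ c) (+ n) (+ k) (+ l) ⟩
    (+ k -ℤ + l) *ℤ + n                              ∎))
  where
  open ≡-Reasoning
  open ℤ using (+_) renaming (_+_ to _+ℤ_; _*_ to _*ℤ_; _-_ to _-ℤ_)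
  cast : ∀ k → + (c + n * k) ≡ + c +ℤ + n *ℤ + k
  cast k = trans (ℤₚ.pos-+ c (n * k)) (cong (+ c +ℤ_) (ℤₚ.pos-* n k))
  difference : ∀ c n k l → (c +ℤ n *ℤ k) -ℤ (c +ℤ n *ℤ l) ≡ (k -ℤ l) *ℤ n
  difference = ℤ-Ring.solve-∀

*-cancelˡ-≡⁺ : ∀ {p a b c} → Prime p → p ∤ c → c * a ≡⁺ c * b [mod p ] → a ≡⁺ b [mod p ]
*-cancelˡ-≡⁺ {p} {c = zero} _ p∤0 _ = ⊥-elim (p∤0 (p ∣0))
*-cancelˡ-≡⁺ {p} {a} {b} {c@(suc _)} pp p∤c (addMultiple k ca≡cb+pk) = ∣∸⇒≡⁺ b≤a p∣a∸b
  where
  b≤a : b ≤ a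
  b≤a = *-cancelˡ-≤ c (subst (c * b ≤_) (sym ca≡cb+pk) (m≤m+n (c * b) (p * k)))
  c[a∸b]≡pk : c * (a ∸ b) ≡ p * k
  c[a∸b]≡pk = +-cancelˡ-≡ (c * b) _ _
    (trans (sym (*-distribˡ-+ c b (a ∸ b))) (trans (cong (c *_) (m+[n∸m]≡n b≤a)) ca≡cb+pk))
  p∣a∸b : p ∣ a ∸ b
  p∣a∸b = [ ⊥-elim ∘ p∤c , id ]′ (euclidsLemma c (a ∸ b) pp (divides k (trans c[a∸b]≡pk (*-comm p k))))

binomial-mod-square : ∀ x y e → (x + y) ^ suc e ≡⁺ x ^ suc e + suc e * x ^ e * y [mod y * y ]
binomial-mod-square x y zero    = ≡⇒≡⁺ (solve x y)
  where
  solve : ∀ x y → (x + y) * 1 ≡ x * 1 + 1 * 1 * y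
  solve = solve-∀
binomial-mod-square x y (suc e) = begin
  (x + y) * (x + y) ^ suc e                             ∼⟨ *-congˡ-≡⁺ (x + y) (binomial-mod-square x y e) ⟩
  (x + y) * (x ^ suc e + suc e * x ^ e * y)             ∼⟨ addMultiple (suc e * x ^ e) (expand x y (x ^ e) e) ⟩
  x ^ suc (suc e) + suc (suc e) * x ^ suc e * y         ∎
  where
  open ≡⁺-Reasoning (y * y)
  expand : ∀ x y z e → (x + y) * (x * z + (1 + e) * z * y)
                      ≡ x * (x * z) + (2 + e) * (x * z) * y + y * y * ((1 + e) * z)
  expand = solve-∀

module _ (x : ℕ) where
  open Binomial +-*-semiring x 1 using (binomialExpansion; theorem)
  open RawSemiring +-*-rawSemiring using () renaming (_^_ to _^ₛ_; _×_ to _×ₛ_; sum to sumₛ)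

  binomial-theorem : ∀ n → (x + 1) ^ n ≡ ∑[ k < suc n ] ((n C k) * x ^ k)
  binomial-theorem n = begin
    (x + 1) ^ n                                                   ≡⟨ ^ₛ≡^ (x + 1) n ⟨
    (x + 1) ^ₛ n                                                  ≡⟨ theorem (*-comm x 1) n ⟩
    binomialExpansion n                                           ≡⟨ sumₛ≡∑ (suc n) term ⟩
    ∑[ k < suc n ] term k                                         ≡⟨ ∑-cong (suc n) (λ k _ → term≡ k) ⟩
    ∑[ k < suc n ] ((n C k) * x ^ k)                              ∎
    where
    open ≡-Reasoning
    ^ₛ≡^ : ∀ y m → y ^ₛ m ≡ y ^ m
    ^ₛ≡^ y zero    = refl
    ^ₛ≡^ y (suc m) = cong (y *_) (^ₛ≡^ y m)
    ×ₛ≡* : ∀ m y → m ×ₛ y ≡ m * y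
    ×ₛ≡* zero    y = refl
    ×ₛ≡* (suc m) y = cong (y +_) (×ₛ≡* m y)
    sumₛ≡∑ : ∀ m (f : ℕ → ℕ) → sumₛ {m} (λ i → f (toℕ i)) ≡ ∑ m f
    sumₛ≡∑ zero    f = refl
    sumₛ≡∑ (suc m) f = cong (f 0 +_) (sumₛ≡∑ m (f ∘ suc))
    term : ℕ → ℕ
    term k = (n C k) ×ₛ (x ^ₛ k * 1 ^ₛ (n ∸ k))
    term≡ : ∀ k → term k ≡ (n C k) * x ^ k
    term≡ k = begin
      (n C k) ×ₛ (x ^ₛ k * 1 ^ₛ (n ∸ k))   ≡⟨ ×ₛ≡* (n C k) _ ⟩
      (n C k) * (x ^ₛ k * 1 ^ₛ (n ∸ k))    ≡⟨ cong₂ (λ a b → (n C k) * (a * b)) (^ₛ≡^ x k) 1^ₛ≡1 ⟩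
      (n C k) * (x ^ k * 1)                ≡⟨ cong ((n C k) *_) (*-identityʳ (x ^ k)) ⟩
      (n C k) * x ^ k                      ∎
      where
      1^ₛ≡1 : 1 ^ₛ (n ∸ k) ≡ 1
      1^ₛ≡1 = trans (^ₛ≡^ 1 (n ∸ k)) (^-zeroˡ (n ∸ k))

C-absorption : ∀ n k → suc k * (suc n C suc k) ≡ suc n * (n C k)
C-absorption zero    zero    = refl
C-absorption zero    (suc k) = *-zeroʳ (suc (suc k))
C-absorption (suc n) zero    =
  trans (*-identityˡ _) (trans (nC1≡n (suc (suc n))) (sym (*-identityʳ (suc (suc n)))))
C-absorption (suc n) (suc k) = begin
  (2 + k) * (suc N C suc K)                      ≡⟨ cong ((2 + k) *_) (nCk+nC[k+1]≡[n+1]C[k+1] N K) ⟨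
  (2 + k) * (N C K + N C suc K)                  ≡⟨ regroup k (N C K) (N C suc K) ⟩
  N C K + (K * (N C K) + (2 + k) * (N C suc K))
      ≡⟨ cong₂ (λ a b → N C K + (a + b)) (C-absorption n k) (C-absorption n K) ⟩
  N C K + (N * (n C k) + N * (n C K))            ≡⟨ cong (N C K +_) (*-distribˡ-+ N (n C k) (n C K)) ⟨
  N C K + N * (n C k + n C K)                    ≡⟨ cong (λ c → N C K + N * c) (nCk+nC[k+1]≡[n+1]C[k+1] n k) ⟩
  suc N * (N C K)                                ∎
  where
  open ≡-Reasoning
  N = suc n
  K = suc k
  regroup : ∀ k a b → (2 + k) * (a + b) ≡ a + ((1 + k) * a + (2 + k) * b)
  regroup = solve-∀

prime∣C : ∀ {p k} → Prime p → 0 < k → k < p → p ∣ p C k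
prime∣C {suc p′} {suc k′} pp 0<k k<p =
  [ ⊥-elim ∘ >⇒∤ k<p , id ]′ (euclidsLemma (suc k′) (suc p′ C suc k′) pp p∣k*C)
  where
  p∣k*C : suc p′ ∣ suc k′ * (suc p′ C suc k′)
  p∣k*C = divides (p′ C k′) (trans (C-absorption p′ k′) (*-comm (suc p′) (p′ C k′)))

freshman's-dream : ∀ {p} → Prime p → ∀ x → (x + 1) ^ p ≡⁺ x ^ p + 1 [mod p ]
freshman's-dream {suc p′} pp x = begin
  (x + 1) ^ p                                ≡⟨ binomial-theorem x p ⟩
  ∑ (suc p) term                             ≡⟨ ∑-init-last p term ⟩
  1 + ∑[ k < p′ ] term (suc k) + term p
      ∼⟨ +-cong-≡⁺ (+-cong-≡⁺ (≡⁺-refl {a = 1}) inner≡⁺0) ≡⁺-refl ⟩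
  1 + ∑[ k < p′ ] 0 + (p C p) * x ^ p
      ≡⟨ cong₂ (λ s c → 1 + s + c * x ^ p) (trans (∑-const p′ 0) (*-zeroʳ p′)) (nCn≡1 p) ⟩
  1 + 0 + 1 * x ^ p                          ≡⟨ +-comm 1 (1 * x ^ p) ⟩
  1 * x ^ p + 1                              ≡⟨ cong (_+ 1) (*-identityˡ (x ^ p)) ⟩
  x ^ p + 1                                  ∎
  where
  p = suc p′
  open ≡⁺-Reasoning p
  term : ℕ → ℕ
  term k = (p C k) * x ^ k
  inner≡⁺0 : ∑[ k < p′ ] term (suc k) ≡⁺ ∑[ k < p′ ] 0 [mod p ]
  inner≡⁺0 = ∑-cong-≡⁺ p′ (λ k k<p′ →
    ∣⇒≡⁺0 (∣m⇒∣m*n (x ^ suc k) (prime∣C pp (s≤s z≤n) (s≤s k<p′))))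

fermat : ∀ {p} → Prime p → ∀ a → a ^ p ≡⁺ a [mod p ]
fermat {suc p′} pp zero    = ≡⁺-refl
fermat {p}      pp (suc a) = begin
  suc a ^ p     ≡⟨ cong (_^ p) (+-comm 1 a) ⟩
  (a + 1) ^ p   ∼⟨ freshman's-dream pp a ⟩
  a ^ p + 1     ∼⟨ +-cong-≡⁺ (fermat pp a) ≡⁺-refl ⟩
  a + 1         ≡⟨ +-comm a 1 ⟩
  suc a         ∎
  where open ≡⁺-Reasoning p

fermat-little : ∀ {p a} → Prime p → p ∤ a → a ^ (p ∸ 1) ≡⁺ 1 [mod p ]
fermat-little {suc p′} {a} pp p∤a =
  *-cancelˡ-≡⁺ pp p∤a (≡⁺-trans (fermat pp a) (≡⇒≡⁺ (sym (*-identityʳ a))))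

fermat-little-∣ : ∀ {p a e} → Prime p → p ∤ a → p ∸ 1 ∣ e → a ^ e ≡⁺ 1 [mod p ]
fermat-little-∣ {p} {a} pp p∤a (divides q refl) = begin
  a ^ (q * (p ∸ 1))    ≡⟨ cong (a ^_) (*-comm q (p ∸ 1)) ⟩
  a ^ ((p ∸ 1) * q)    ≡⟨ ^-*-assoc a (p ∸ 1) q ⟨
  (a ^ (p ∸ 1)) ^ q    ∼⟨ ^-cong-≡⁺ q (fermat-little pp p∤a) ⟩
  1 ^ q                ≡⟨ ^-zeroˡ q ⟩
  1                    ∎
  where open ≡⁺-Reasoning p

m∣[1+m]^f∸1 : ∀ m f → m ∣ suc m ^ f ∸ 1
m∣[1+m]^f∸1 m f = ≡⁺⇒∣∸ (begin
  suc m ^ f   ∼⟨ ^-cong-≡⁺ f (addMultiple 1 (cong suc (sym (*-identityʳ m)))) ⟩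
  1 ^ f       ≡⟨ ^-zeroˡ f ⟩
  1           ∎)
  where open ≡⁺-Reasoning m

Odd : ℕ → Set
Odd p = ∃[ r ] p ≡ suc (2 * r)

odd-prime : ∀ {p} → Prime p → p ≢ 2 → Odd p
odd-prime {p} pp p≢2 with p % 2 | m%n<n p 2 | m≡m%n+[m/n]*n p 2
... | 0 | _ | p≡[p/2]*2 with prime⇒irreducible pp (divides (p / 2) p≡[p/2]*2)
...   | inj₁ ()
...   | inj₂ 2≡p = ⊥-elim (p≢2 (sym 2≡p))
odd-prime {p} pp p≢2 | 1 | _ | p≡1+[p/2]*2 = p / 2 , trans p≡1+[p/2]*2 (cong suc (*-comm (p / 2) 2))
odd-prime {p} pp p≢2 | suc (suc _) | s≤s (s≤s ()) | _

-- Modulo (P s)², and hence modulo p P, (a + P s) ^ (e + 1) is a ^ (e + 1) + (e + 1) a ^ e P s. Summed over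
-- s < p the linear terms give (e + 1) a ^ e P p (p - 1) / 2, a multiple of p P because p is odd.
∑-progression-period : ∀ {p P} → Odd p → p ∣ P → ∀ a e →
  ∑[ s < p ] ((a + P * s) ^ e) ≡⁺ p * a ^ e [mod p * P ]
∑-progression-period {p} {P} (r , refl) p∣P a zero    = ≡⇒≡⁺ (∑-const p 1)
∑-progression-period {p} {P} (r , refl) p∣P a (suc e) = begin
  ∑[ s < p ] ((a + P * s) ^ suc e)
      ∼⟨ ∑-cong-≡⁺ p (λ s _ → ∣-weaken-≡⁺ (pP∣[Ps]² s) (binomial-mod-square a (P * s) e)) ⟩
  ∑[ s < p ] (A + c * (P * s))                    ≡⟨ ∑-distrib-+ p (λ _ → A) (λ s → c * (P * s)) ⟩
  ∑[ s < p ] A + ∑[ s < p ] (c * (P * s))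
      ≡⟨ cong₂ _+_ (∑-const p A) (trans (*-distribˡ-∑ p c (P *_)) (cong (c *_) (*-distribˡ-∑ p P id))) ⟩
  p * A + c * (P * ∑[ s < p ] s)                  ≡⟨ cong (λ t → p * A + c * (P * t)) (∑-id-odd r) ⟩
  p * A + c * (P * (p * r))                       ≡⟨ cong (p * A +_) (regroup c P p r) ⟩
  p * A + p * P * (c * r)                         ∼⟨ m+n*o≡⁺m (p * A) (p * P) (c * r) ⟩
  p * A                                           ∎
  where
  open ≡⁺-Reasoning (p * P)
  A = a ^ suc e
  c = suc e * a ^ e
  pP∣[Ps]² : ∀ s → p * P ∣ P * s * (P * s)
  pP∣[Ps]² s = *-pres-∣ (∣m⇒∣m*n s p∣P) (m∣m*n s)
  regroup : ∀ c P p r → c * (P * (p * r)) ≡ p * P * (c * r)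
  regroup = solve-∀

∑-progression : ∀ {p P} → Odd p → p ∣ P → ∀ m a e →
  ∑[ t < p ^ m ] ((a + P * t) ^ e) ≡⁺ p ^ m * a ^ e [mod p ^ m * P ]
∑-progression {P = P} odd p∣P zero a e = ≡⇒≡⁺ (begin
  (a + P * 0) ^ e + 0 ≡⟨ +-identityʳ _ ⟩
  (a + P * 0) ^ e     ≡⟨ cong (λ t → (a + t) ^ e) (*-zeroʳ P) ⟩
  (a + 0) ^ e         ≡⟨ cong (_^ e) (+-identityʳ a) ⟩
  a ^ e               ≡⟨ *-identityˡ (a ^ e) ⟨
  1 * a ^ e           ∎)
  where open ≡-Reasoning
∑-progression {p} {P} odd p∣P (suc m) a e = ∣-weaken-≡⁺ (∣-reflexive (*-assoc p M P)) (begin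
  ∑ (p * M) h                                          ≡⟨ ∑-blocks p M h ⟩
  ∑[ u < M ] ∑[ s < p ] h (s * M + u)
      ≡⟨ ∑-cong M (λ u _ → ∑-cong p (λ s _ → cong (_^ e) (reindex a P M s u))) ⟩
  ∑[ u < M ] ∑[ s < p ] ((a + P * u + M * P * s) ^ e)
      ∼⟨ ∑-cong-≡⁺ M (λ u _ → ∑-progression-period odd (∣n⇒∣m*n M p∣P) (a + P * u) e) ⟩
  ∑[ u < M ] (p * (a + P * u) ^ e)                     ≡⟨ *-distribˡ-∑ M p (λ u → (a + P * u) ^ e) ⟩
  p * ∑[ u < M ] ((a + P * u) ^ e)                     ∼⟨ *-scale-≡⁺ p (∑-progression odd p∣P m a e) ⟩
  p * (M * a ^ e)                                      ≡⟨ *-assoc p M (a ^ e) ⟨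
  p * M * a ^ e                                        ∎)
  where
  M = p ^ m
  open ≡⁺-Reasoning (p * (M * P))
  h : ℕ → ℕ
  h t = (a + P * t) ^ e
  reindex : ∀ a P M s u → a + P * (s * M + u) ≡ a + P * u + M * P * s
  reindex = solve-∀

∤prime⇒coprime : ∀ {p d} → Prime p → p ∤ d → Coprime d p
∤prime⇒coprime pp p∤d (i∣d , i∣p) with prime⇒irreducible pp i∣p
... | inj₁ i≡1 = i≡1
... | inj₂ refl = ⊥-elim (p∤d i∣d)

∣prime^⇒≡prime^ : ∀ {p d} → Prime p → ∀ f → d ∣ p ^ f → ∃[ g ] d ≡ p ^ g
∣prime^⇒≡prime^ pp zero d∣1 = 0 , ∣1⇒≡1 d∣1
∣prime^⇒≡prime^ {p} {d} pp (suc f) d∣p^[1+f] with p ∣? d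
... | no p∤d = ∣prime^⇒≡prime^ pp f (coprime-divisor (∤prime⇒coprime pp p∤d) d∣p^[1+f])
... | yes (divides d′ refl) with ∣prime^⇒≡prime^ pp f (*-cancelˡ-∣ p {{prime⇒nonZero pp}} p*d′∣p*p^f)
  where
  p*d′∣p*p^f : p * d′ ∣ p * p ^ f
  p*d′∣p*p^f = subst (_∣ p ^ suc f) (*-comm d′ p) d∣p^[1+f]
...   | g , refl = suc g , *-comm (p ^ g) p

prime>1 : ∀ {p} → Prime p → 1 < p
prime>1 {p} pp = nonTrivial⇒n>1 p {{prime⇒nonTrivial pp}}

prime^-injective : ∀ {p a b} → Prime p → p ^ a ≡ p ^ b → a ≡ b
prime^-injective {p} {a} {b} pp eq with <-cmp a b
... | tri< a<b _ _ = ⊥-elim (<-irrefl eq (^-monoʳ-< p (prime>1 pp) a<b))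
... | tri≈ _ a≡b _ = a≡b
... | tri> _ _ b<a = ⊥-elim (<-irrefl (sym eq) (^-monoʳ-< p (prime>1 pp) b<a))

∤prime⇒gcd≡1 : ∀ {p k} → Prime p → ∀ f → p ∤ k → gcd k (p ^ f) ≡ 1
∤prime⇒gcd≡1 {p} {k} pp f p∤k with ∣prime^⇒≡prime^ pp f (gcd[m,n]∣n k (p ^ f))
... | zero  , gcd≡1       = gcd≡1
... | suc g , gcd≡p^[1+g] =
  ⊥-elim (p∤k (∣-trans (divides (p ^ g) (trans gcd≡p^[1+g] (*-comm p (p ^ g)))) (gcd[m,n]∣m k (p ^ f))))

sum-filter-applyUpTo : ∀ {ℓ} {P : Pred ℕ ℓ} (P? : Decidable P) (h f : ℕ → ℕ) m →
  sum (map h (filter P? (applyUpTo f m))) ≡ ∑[ k < m ] (if does (P? (f k)) then h (f k) else 0)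
sum-filter-applyUpTo P? h f zero    = refl
sum-filter-applyUpTo P? h f (suc m) with does (P? (f 0))
... | true  = cong (h (f 0) +_) (sum-filter-applyUpTo P? h (f ∘ suc) m)
... | false = sum-filter-applyUpTo P? h (f ∘ suc) m

length≡sum-ones : ∀ (xs : List ℕ) → length xs ≡ sum (map (λ _ → 1) xs)
length≡sum-ones []       = refl
length≡sum-ones (x ∷ xs) = cong suc (length≡sum-ones xs)

coprimePower : ℕ → ℕ → ℕ → ℕ
coprimePower n e k = if does (gcd k n ≟ 1) then k ^ e else 0

weakSum≡∑ : ∀ n → weakSum n ≡ ∑[ k < n ∸ 1 ] coprimePower n (n ∸ 1) (suc k)
weakSum≡∑ n = sum-filter-applyUpTo (λ k → gcd k n ≟ 1) (_^ (n ∸ 1)) suc (n ∸ 1)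

φ≡∑ : ∀ n → φ n ≡ ∑[ k < n ] coprimePower n 0 (suc k)
φ≡∑ n = trans (length≡sum-ones (filter (λ k → gcd k n ≟ 1) (applyUpTo suc n)))
              (sum-filter-applyUpTo (λ k → gcd k n ≟ 1) (λ _ → 1) suc n)

coprimePower-∣ : ∀ {p k} → Prime p → ∀ f e → p ∣ k → coprimePower (p ^ suc f) e k ≡ 0
coprimePower-∣ {p} {k} pp f e p∣k = cong (if_then k ^ e else 0) (dec-false (gcd k (p ^ suc f) ≟ 1) gcd≢1)
  where
  gcd≢1 : gcd k (p ^ suc f) ≢ 1
  gcd≢1 gcd≡1 = ¬prime[1] (subst Prime (∣1⇒≡1 p∣1) pp)
    where
    p∣1 : p ∣ 1
    p∣1 = subst (p ∣_) gcd≡1 (gcd-greatest p∣k (m∣m*n (p ^ f)))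

coprimePower-∤ : ∀ {p k} → Prime p → ∀ f e → p ∤ k → coprimePower (p ^ f) e k ≡ k ^ e
coprimePower-∤ {p} {k} pp f e p∤k =
  cong (if_then k ^ e else 0) (dec-true (gcd k (p ^ f) ≟ 1) (∤prime⇒gcd≡1 pp f p∤k))

-- Sort k = t p + s by its residue s: the class s = 0 vanishes, and each class 0 < s < p contributes
-- p ^ f s ^ e by ∑-progression, which is p ^ f modulo p ^ (f + 1) under the hypothesis on e.
∑-coprimePower : ∀ {p} → Prime p → Odd p → ∀ f e → (∀ s → 0 < s → s < p → s ^ e ≡⁺ 1 [mod p ]) →
  ∑[ k < p ^ suc f ] coprimePower (p ^ suc f) e k ≡⁺ (p ∸ 1) * p ^ f [mod p ^ suc f ]
∑-coprimePower pp odd@(r , refl) f e s^e≡⁺1 = ∣-weaken-≡⁺ (∣-reflexive (*-comm p q)) (begin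
  ∑ (p * q) G                                              ≡⟨ cong (λ m → ∑ m G) (*-comm p q) ⟩
  ∑ (q * p) G                                              ≡⟨ ∑-blocks q p G ⟩
  ∑[ t < q ] G (t * p + 0) + ∑[ s < 2 * r ] ∑[ t < q ] G (t * p + suc s)
      ≡⟨ cong₂ _+_ zero-class (∑-cong (2 * r) (λ s s<2r → ∑-cong q (λ t _ → unit-class s t s<2r))) ⟩
  0 + ∑[ s < 2 * r ] ∑[ t < q ] ((suc s + p * t) ^ e)     ∼⟨ ∑-cong-≡⁺ (2 * r) unit-class-sum ⟩
  ∑[ s < 2 * r ] (q * 1)                                   ≡⟨ ∑-const (2 * r) (q * 1) ⟩
  2 * r * (q * 1)                                          ≡⟨ cong (2 * r *_) (*-identityʳ q) ⟩
  2 * r * q                                                ∎)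
  where
  p = suc (2 * r)
  q = p ^ f
  G = coprimePower (p ^ suc f) e
  open ≡⁺-Reasoning (q * p)
  zero-class : ∑[ t < q ] G (t * p + 0) ≡ 0
  zero-class = trans (∑-cong q (λ t _ → coprimePower-∣ pp f e (divides t (+-identityʳ (t * p)))))
                     (trans (∑-const q 0) (*-zeroʳ q))
  unit-class : ∀ s t → s < 2 * r → G (t * p + suc s) ≡ (suc s + p * t) ^ e
  unit-class s t s<2r = trans (coprimePower-∤ pp (suc f) e p∤tp+1+s) (cong (_^ e) tp+1+s≡1+s+pt)
    where
    p∤tp+1+s : p ∤ t * p + suc s
    p∤tp+1+s p∣ = >⇒∤ (s≤s s<2r) (∣m+n∣m⇒∣n p∣ (n∣m*n t))
    tp+1+s≡1+s+pt : t * p + suc s ≡ suc s + p * t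
    tp+1+s≡1+s+pt = trans (+-comm (t * p) (suc s)) (cong (suc s +_) (*-comm t p))
  unit-class-sum : ∀ s → s < 2 * r → ∑[ t < q ] ((suc s + p * t) ^ e) ≡⁺ q * 1 [mod q * p ]
  unit-class-sum s s<2r =
    ≡⁺-trans (∑-progression odd ∣-refl f (suc s) e) (*-scale-≡⁺ q (s^e≡⁺1 (suc s) (s≤s z≤n) (s≤s s<2r)))

weakSum≡φ[mod-prime^] : ∀ {p} → Prime p → Odd p → ∀ f →
  weakSum (p ^ suc f) ≡ φ (p ^ suc f) [mod p ^ suc f ]
weakSum≡φ[mod-prime^] pp odd@(r , refl) f = ≡⁺-common⇒≡[mod] weakSum≡⁺ φ≡⁺
  where
  p = suc (2 * r)
  n = p ^ suc f
  open ≡⁺-Reasoning n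
  G : ℕ → ℕ → ℕ
  G e = coprimePower n e
  G[0]≡0 : ∀ e → G e 0 ≡ 0
  G[0]≡0 e = coprimePower-∣ pp f e (p ∣0)
  fermat-n∸1 : ∀ s → 0 < s → s < p → s ^ (n ∸ 1) ≡⁺ 1 [mod p ]
  fermat-n∸1 (suc s) _ s<p = fermat-little-∣ pp (>⇒∤ s<p) (m∣[1+m]^f∸1 (2 * r) (suc f))
  weakSum≡⁺ : weakSum n ≡⁺ 2 * r * p ^ f [mod n ]
  weakSum≡⁺ = begin
    weakSum n                                ≡⟨ weakSum≡∑ n ⟩
    ∑[ k < n ∸ 1 ] G (n ∸ 1) (suc k)
        ≡⟨ cong (_+ ∑[ k < n ∸ 1 ] G (n ∸ 1) (suc k)) (G[0]≡0 (n ∸ 1)) ⟨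
    ∑ (suc (n ∸ 1)) (G (n ∸ 1))
        ≡⟨ cong (λ m → ∑ m (G (n ∸ 1))) (m+[n∸m]≡n (m^n>0 p (suc f))) ⟩
    ∑ n (G (n ∸ 1))                          ∼⟨ ∑-coprimePower pp odd f (n ∸ 1) fermat-n∸1 ⟩
    2 * r * p ^ f                            ∎
  φ≡⁺ : φ n ≡⁺ 2 * r * p ^ f [mod n ]
  φ≡⁺ = begin
    φ n                                      ≡⟨ φ≡∑ n ⟩
    ∑[ k < n ] G 0 (suc k)                   ≡⟨ cong (_+ ∑[ k < n ] G 0 (suc k)) (G[0]≡0 0) ⟨
    ∑ (suc n) (G 0)                          ≡⟨ ∑-init-last n (G 0) ⟩
    ∑ n (G 0) + G 0 n                        ≡⟨ cong (∑ n (G 0) +_) (coprimePower-∣ pp f 0 (m∣m*n (p ^ f))) ⟩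
    ∑ n (G 0) + 0                            ≡⟨ +-identityʳ _ ⟩
    ∑ n (G 0)                                ∼⟨ ∑-coprimePower pp odd f 0 (λ _ _ _ → ≡⁺-refl) ⟩
    2 * r * p ^ f                            ∎

composite⇒product : ∀ {n} → Composite n → ∃[ a ] ∃[ b ] 2 ≤ a × 2 ≤ b × n ≡ a * b
composite⇒product (hasNonTrivialDivisor d<0 (divides zero refl)) = ⊥-elim (n≮0 d<0)
composite⇒product (hasNonTrivialDivisor {d} d<d+0 (divides 1 refl)) =
  ⊥-elim (<-irrefl (sym (+-identityʳ d)) d<d+0)
composite⇒product (hasNonTrivialDivisor {d} _ (divides c@(2+ _) n≡c*d)) =
  c , d , s≤s (s≤s z≤n) , nonTrivial⇒n>1 d , n≡c*d

product⇒composite : ∀ {a b} → 2 ≤ a → 2 ≤ b → Composite (a * b)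
product⇒composite {a@(2+ _)} {b} (s≤s (s≤s _)) 2≤b =
  hasNonTrivialDivisor {divisor = a} (m<m*n a b 2≤b) (m∣m*n b)

weakCarmichael-prime^⇔ : ∀ {p} → Prime p → p ≢ 2 → ∀ f → WeakCarmichael (p ^ f) ⇔ 2 ≤ f
weakCarmichael-prime^⇔ {p} pp p≢2 f = mk⇔ (composite⇒2≤ f ∘ proj₁) 2≤⇒weakCarmichael
  where
  composite⇒2≤ : ∀ f → Composite (p ^ f) → 2 ≤ f
  composite⇒2≤ zero          c = ⊥-elim (¬composite[1] c)
  composite⇒2≤ (suc zero)    c = ⊥-elim (prime⇒¬composite pp (subst Composite (*-identityʳ p) c))
  composite⇒2≤ (suc (suc _)) _ = s≤s (s≤s z≤n)
  2≤⇒weakCarmichael : 2 ≤ f → WeakCarmichael (p ^ f)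
  2≤⇒weakCarmichael (s≤s (s≤s {n = f′} _)) =
    product⇒composite (prime>1 pp) (^-monoʳ-< p (prime>1 pp) (s≤s (z≤n {f′}))) ,
    weakSum≡φ[mod-prime^] pp (odd-prime pp p≢2) (suc f′)

primitive⇒prime : ∀ {p f} → Prime p → p ≢ 2 → PrimitiveWeakCarmichael (p ^ f) → Prime f
primitive⇒prime {p} {f} pp p≢2 (wc , not-a-power) = ¬composite⇒prime {{n>1⇒nonTrivial 2≤f}} ¬composite
  where
  open Equivalence
  2≤f : 2 ≤ f
  2≤f = to (weakCarmichael-prime^⇔ pp p≢2 f) wc
  ¬composite : ¬ Composite f
  ¬composite c with composite⇒product c
  ... | a , b , 2≤a , 2≤b , f≡a*b =
    not-a-power (p ^ b) a (from (weakCarmichael-prime^⇔ pp p≢2 b) 2≤b) 2≤a (begin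
    p ^ f         ≡⟨ cong (p ^_) (trans f≡a*b (*-comm a b)) ⟩
    p ^ (b * a)   ≡⟨ ^-*-assoc p b a ⟨
    (p ^ b) ^ a   ∎)
    where open ≡-Reasoning

prime⇒primitive : ∀ {p f} → Prime p → p ≢ 2 → Prime f → PrimitiveWeakCarmichael (p ^ f)
prime⇒primitive {p} {f} pp p≢2 pf = from (weakCarmichael-prime^⇔ pp p≢2 f) (prime>1 pf) , not-a-power
  where
  open Equivalence
  not-a-power : ∀ m h → WeakCarmichael m → h ≥ 2 → p ^ f ≡ m ^ h → ⊥
  not-a-power m (suc h′) wc 2≤h p^f≡m^h
    with ∣prime^⇒≡prime^ pp f (subst (m ∣_) (sym p^f≡m^h) (m∣m*n (m ^ h′)))
  ... | g , refl = prime⇒¬composite pf (subst Composite (sym f≡g*h) (product⇒composite 2≤g 2≤h))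
    where
    2≤g : 2 ≤ g
    2≤g = to (weakCarmichael-prime^⇔ pp p≢2 g) wc
    f≡g*h : f ≡ g * suc h′
    f≡g*h = prime^-injective pp (trans p^f≡m^h (^-*-assoc p g (suc h′)))

corollary2p27 : (p f : ℕ) → Prime p → p ≢ 2 → f ≥ 1 →
    PrimitiveWeakCarmichael (p ^ f) ⇔ Prime f
corollary2p27 p f pp p≢2 _ = mk⇔ (primitive⇒prime pp p≢2) (prime⇒primitive pp p≢2)
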